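{- Let $\mathrm{sort}$ be a sort function satisfying the characteristic property. For every type $T$, every total preorder $\leq$ on $T$, every $x : T$ and every $s : \mathrm{list}\,T$, writing $x \equiv y$ for $x \leq y \wedge y \leq x$, we have $\mathrm{filter}\,(\lambda y.\, x \equiv y)\,(\mathrm{sort}_\leq\,s) = \mathrm{filter}\,(\lambda y.\, x \equiv y)\,s$.
   Context: A total preorder is a relation that is transitive and total. $\mathrm{filter}\,p\,xs$ is the list of the elements of $xs$ satisfying $p$, in their original order. Lists: $[]$ is the empty list, $x :: s$ is cons, $[x]$ is the singleton list, $\mathbin{+\!\!+}$ is concatenation. A "relation" $\leq$ on a type $T$ is a function $T \to T \to \mathrm{bool}$. The merge of two lists w.r.t. $\leq$ is defined by $[] \mathbin{\land\hspace{ -.45em}\land}_\leq ys = ys$, $xs \mathbin{\land\hspace{ -.45em}\land}_\leq [] = xs$, and $(x :: xs) \mathbin{\land\hspace{ -.45em}\land}_\leq (y :: ys) = x :: (xs \mathbin{\land\hspace{ -.45em}\land}_\leq (y :: ys))$ if $x \leq y$, and $= y :: ((x :: xs) \mathbin{\land\hspace{ -.45em}\land}_\leq ys)$ otherwise. A sort function $\mathrm{sort}$ assigns to every type $T$ and relation $\leq$ on $T$ a function $\mathrm{sort}_\leq : \mathrm{list}\,T \to \mathrm{list}\,T$. It satisfies the characteristic property if there is a polymorphic function $\mathrm{asort}$ of type $\forall (T\,R : \mathcal{U}), (R \to R \to R) \to (T \to R) \to R \to \mathrm{list}\,T \to R$ such that: (1) for all $T$, $\leq$, $xs$: $\mathrm{asort}\,(\mathbin{\land\hspace{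 -.45em}\land}_\leq)\,(\lambda x.[x])\,[]\,xs = \mathrm{sort}_\leq\,xs$; (2) for all $T$, $xs$: $\mathrm{asort}\,(\mathbin{+\!\!+})\,(\lambda x.[x])\,[]\,xs = xs$; (3) $\mathrm{asort}$ is relationally parametric: for all types $T_1,T_2$ and relation $\sim_T \subseteq T_1 \times T_2$, all types $R_1,R_2$ and relation $\sim_R \subseteq R_1\times R_2$, all $m_i : R_i \to R_i \to R_i$ with $a_1 \sim_R a_2 \wedge b_1 \sim_R b_2 \Rightarrow m_1\,a_1\,b_1 \sim_R m_2\,a_2\,b_2$, all $s_i : T_i \to R_i$ with $x_1 \sim_T x_2 \Rightarrow s_1\,x_1 \sim_R s_2\,x_2$, all $e_i : R_i$ with $e_1 \sim_R e_2$, and all lists $xs_1 : \mathrm{list}\,T_1$, $xs_2 : \mathrm{list}\,T_2$ of equal length that are pointwise $\sim_T$-related, we have $\mathrm{asort}\,m_1\,s_1\,e_1\,xs_1 \sim_R \mathrm{asort}\,m_2\,s_2\,e_2\,xs_2$. -}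

module Defs where

open import Data.Bool using (Bool; true; false; if_then_else_)
open import Data.List using (List; []; _∷_; _++_; [_])
open import Data.List.Relation.Binary.Pointwise using (Pointwise)
open import Relation.Binary.PropositionalEquality using (_≡_)
open import Data.Product using (_×_)
open import Data.Sum using (_⊎_)

BRel : Set → Set
BRel T = T → T → Bool

filterB : {T : Set} → (T → Bool) → List T → List T
filterB p [] = []
filterB p (x ∷ xs) = if p x then x ∷ filterB p xs else filterB p xs

-- merge of two lists w.r.t. ≤ :
--   merge [] ys = ys ; merge xs [] = xs ;
--   merge (x ∷ xs) (y ∷ ys) = if x ≤ y then x ∷ merge xs (y ∷ ys)
--                                       else y ∷ merge (x ∷ xs) ys
merge : {T : Set} → BRel T → List T → List T → List T
merge {T} leq [] ys = ys
merge {T} leq (x ∷ xs) ys = go ys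
  where
  go : List T → List T
  go [] = x ∷ xs
  go (y ∷ ys') = if leq x y then x ∷ merge leq xs (y ∷ ys') else y ∷ go ys'

IsTotalPreorderB : {T : Set} → BRel T → Set
IsTotalPreorderB {T} leq =
  ((x y z : T) → leq x y ≡ true → leq y z ≡ true → leq x z ≡ true) ×
  ((x y : T) → (leq x y ≡ true) ⊎ (leq y x ≡ true))

SortFun : Set₁
SortFun = (T : Set) → BRel T → List T → List T

ASortFun : Set₁
ASortFun = (T R : Set) → (R → R → R) → (T → R) → R → List T → R

Parametric : ASortFun → Set₁
Parametric asort =
  (T₁ T₂ : Set) (RT : T₁ → T₂ → Set)
  (R₁ R₂ : Set) (RR : R₁ → R₂ → Set)
  (m₁ : R₁ → R₁ → R₁) (m₂ : R₂ → R₂ → R₂) →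
  (∀ {a₁ a₂ b₁ b₂} → RR a₁ a₂ → RR b₁ b₂ → RR (m₁ a₁ b₁) (m₂ a₂ b₂)) →
  (s₁ : T₁ → R₁) (s₂ : T₂ → R₂) →
  (∀ {x₁ x₂} → RT x₁ x₂ → RR (s₁ x₁) (s₂ x₂)) →
  (e₁ : R₁) (e₂ : R₂) → RR e₁ e₂ →
  (xs₁ : List T₁) (xs₂ : List T₂) → Pointwise RT xs₁ xs₂ →
  RR (asort T₁ R₁ m₁ s₁ e₁ xs₁) (asort T₂ R₂ m₂ s₂ e₂ xs₂)

record CharacteristicProperty (sort : SortFun) : Set₁ where
  field
    asort : ASortFun
    asort-merge : (T : Set) (leq : BRel T) (xs : List T) →
      asort T (List T) (merge leq) [_] [] xs ≡ sort T leq xs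
    asort-cat : (T : Set) (xs : List T) →
      asort T (List T) _++_ [_] [] xs ≡ xs
    asort-param : Parametric asort

-- Take the parametricity relation between lists to be
--   a ~ b  :=  a is sorted  and  a, b have the same elements equivalent to x, in the same order.
-- The empty list, singletons and the pair (merge, ++) respect it: merging a sorted list xs with
-- any ys cannot reorder elements of one equivalence class, because an element v of ys jumps ahead
-- of the head u of xs only when u ≰ v, and then no element of xs is equivalent to v.
-- Relating asort with merge to asort with ++ (which is the identity) gives the claim.
module Submission where

open import Defs
open import Data.Bool using (Bool; true; false; _∧_; if_then_else_)
open import Data.List using (List; []; _∷_; _++_; [_])
open import Data.List.Properties using (++-identityʳ)
open import Data.List.Relation.Unary.All as All using (All; []; _∷_)
open import Data.List.Relation.Unary.AllPairs using (AllPairs; []; _∷_)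
import Data.List.Relation.Binary.Pointwise as Pointwise
open import Data.Product using (_,_; proj₁; proj₂)
open import Data.Sum using (inj₁; inj₂)
open import Relation.Binary.PropositionalEquality
  using (_≡_; refl; sym; trans; cong; cong₂; module ≡-Reasoning)

filterB-++ : {T : Set} (p : T → Bool) (xs ys : List T) →
  filterB p (xs ++ ys) ≡ filterB p xs ++ filterB p ys
filterB-++ p [] ys = refl
filterB-++ p (x ∷ xs) ys with p x
... | true = cong (x ∷_) (filterB-++ p xs ys)
... | false = filterB-++ p xs ys

filterB-∷-cong : {T : Set} (p : T → Bool) (x : T) (xs ys : List T) →
  filterB p xs ≡ filterB p ys → filterB p (x ∷ xs) ≡ filterB p (x ∷ ys)
filterB-∷-cong p x _ _ xs≈ys = cong (λ l → if p x then x ∷ l else l) xs≈ys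

-- Splitting merge's comparison with if-elim rather than with keeps the recursive calls
-- in the clause itself, where the termination checker sees them decrease.
if-elim : {A : Set} (P : A → Set) (b : Bool) {x y : A} →
  (b ≡ true → P x) → (b ≡ false → P y) → P (if b then x else y)
if-elim P true onTrue _ = onTrue refl
if-elim P false _ onFalse = onFalse refl

∧-≡-trueˡ : ∀ {a b} → a ∧ b ≡ true → a ≡ true
∧-≡-trueˡ {true} _ = refl

∧-≡-trueʳ : ∀ {a b} → a ∧ b ≡ true → b ≡ true
∧-≡-trueʳ {true} b≡true = b≡true

module _ {T : Set} (leq : BRel T) where

  _≤_ : T → T → Set
  a ≤ b = leq a b ≡ true

  _≈ᵇ_ : T → T → Bool
  a ≈ᵇ b = leq a b ∧ leq b a

  Sorted : List T → Set
  Sorted = AllPairs _≤_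

  All-merge : {P : T → Set} (xs ys : List T) → All P xs → All P ys → All P (merge leq xs ys)
  All-merge [] ys _ pys = pys
  All-merge (u ∷ us) [] pxs _ = pxs
  All-merge (u ∷ us) (v ∷ vs) (pu ∷ pus) (pv ∷ pvs) =
    if-elim (All _) (leq u v)
      (λ _ → pu ∷ All-merge us (v ∷ vs) pus (pv ∷ pvs))
      (λ _ → pv ∷ All-merge (u ∷ us) vs (pu ∷ pus) pvs)

  module _ (isTotalPreorder : IsTotalPreorderB leq) where

    private
      ≤-trans : ∀ {a b c} → a ≤ b → b ≤ c → a ≤ c
      ≤-trans = isTotalPreorder .proj₁ _ _ _

    ≤-refl : ∀ a → a ≤ a
    ≤-refl a with isTotalPreorder .proj₂ a a
    ... | inj₁ a≤a = a≤a
    ... | inj₂ a≤a = a≤a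

    ≰⇒≥ : ∀ {a b} → leq a b ≡ false → b ≤ a
    ≰⇒≥ {a} {b} a≰b with isTotalPreorder .proj₂ a b
    ... | inj₂ b≤a = b≤a
    ... | inj₁ a≤b with trans (sym a≰b) a≤b
    ...   | ()

    merge-sorted : ∀ xs ys → Sorted xs → Sorted ys → Sorted (merge leq xs ys)
    merge-sorted [] ys _ sys = sys
    merge-sorted (u ∷ us) [] sxs _ = sxs
    merge-sorted (u ∷ us) (v ∷ vs) (u≤us ∷ sus) (v≤vs ∷ svs) =
      if-elim Sorted (leq u v)
        (λ u≤v → All-merge us (v ∷ vs) u≤us (u≤v ∷ All.map (≤-trans u≤v) v≤vs)
                 ∷ merge-sorted us (v ∷ vs) sus (v≤vs ∷ svs))
        (λ u≰v → let v≤u = ≰⇒≥ u≰v in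
                 All-merge (u ∷ us) vs (v≤u ∷ All.map (≤-trans v≤u) u≤us) v≤vs
                 ∷ merge-sorted (u ∷ us) vs (u≤us ∷ sus) svs)

    module _ (x : T) where

      private
        classOf : List T → List T
        classOf = filterB (x ≈ᵇ_)

      filterB-≈-[] : ∀ {u v} ys → leq u v ≡ false → x ≈ᵇ v ≡ true → All (u ≤_) ys → classOf ys ≡ []
      filterB-≈-[] [] _ _ [] = refl
      filterB-≈-[] (y ∷ ys) u≰v x≈v (u≤y ∷ u≤ys) with x ≈ᵇ y in x≈y
      ... | false = filterB-≈-[] ys u≰v x≈v u≤ys
      ... | true with trans (sym u≰v) (≤-trans (≤-trans u≤y (∧-≡-trueʳ x≈y)) (∧-≡-trueˡ x≈v))
      ...   | ()

      filterB-≈-overtake : ∀ {u v} rest us vs → leq u v ≡ false → All (u ≤_) us →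
        classOf rest ≡ classOf (u ∷ us) ++ classOf vs →
        classOf (v ∷ rest) ≡ classOf (u ∷ us) ++ classOf (v ∷ vs)
      filterB-≈-overtake {u} {v} rest us vs u≰v u≤us rest≈ with x ≈ᵇ v in x≈v
      ... | false = rest≈
      ... | true = begin
        v ∷ classOf rest                        ≡⟨ cong (v ∷_) rest≈ ⟩
        v ∷ (classOf (u ∷ us) ++ classOf vs)    ≡⟨ cong (λ l → v ∷ (l ++ classOf vs)) none ⟩
        v ∷ classOf vs                          ≡⟨ cong (_++ v ∷ classOf vs) none ⟨
        classOf (u ∷ us) ++ v ∷ classOf vs      ∎
        where
          open ≡-Reasoning
          none : classOf (u ∷ us) ≡ []
          none = filterB-≈-[] (u ∷ us) u≰v x≈v (≤-refl u ∷ u≤us)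

      filterB-≈-merge : ∀ xs ys → Sorted xs → classOf (merge leq xs ys) ≡ classOf xs ++ classOf ys
      filterB-≈-merge [] ys _ = refl
      filterB-≈-merge (u ∷ us) [] _ = sym (++-identityʳ _)
      filterB-≈-merge (u ∷ us) (v ∷ vs) (u≤us ∷ sus) =
        if-elim (λ m → classOf m ≡ classOf (u ∷ us) ++ classOf (v ∷ vs)) (leq u v)
          (λ _ → trans (filterB-∷-cong (x ≈ᵇ_) u (merge leq us (v ∷ vs)) (us ++ v ∷ vs)
                          (trans (filterB-≈-merge us (v ∷ vs) sus) (sym (filterB-++ (x ≈ᵇ_) us (v ∷ vs)))))
                       (filterB-++ (x ≈ᵇ_) (u ∷ us) (v ∷ vs)))
          -- The merged tail is passed explicitly: merge's local go keeps the original second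
          -- list as an unused argument, so unification cannot recover it.
          (λ u≰v → filterB-≈-overtake (merge leq (u ∷ us) vs) us vs u≰v u≤us
                     (filterB-≈-merge (u ∷ us) vs (u≤us ∷ sus)))

      record SortedWithClassOf (a b : List T) : Set where
        constructor _,_
        field
          sorted : Sorted a
          sameClass : classOf a ≡ classOf b

      merge-++-SortedWithClassOf : ∀ {a₁ a₂ b₁ b₂} →
        SortedWithClassOf a₁ a₂ → SortedWithClassOf b₁ b₂ → SortedWithClassOf (merge leq a₁ b₁) (a₂ ++ b₂)
      merge-++-SortedWithClassOf {a₁} {a₂} {b₁} {b₂} (sa₁ , a₁≈a₂) (sb₁ , b₁≈b₂) =
        merge-sorted a₁ b₁ sa₁ sb₁ ,
        (begin
          classOf (merge leq a₁ b₁)    ≡⟨ filterB-≈-merge a₁ b₁ sa₁ ⟩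
          classOf a₁ ++ classOf b₁     ≡⟨ cong₂ _++_ a₁≈a₂ b₁≈b₂ ⟩
          classOf a₂ ++ classOf b₂     ≡⟨ filterB-++ _ a₂ b₂ ⟨
          classOf (a₂ ++ b₂)           ∎)
        where open ≡-Reasoning

corollary3p17 : (sort : SortFun) → CharacteristicProperty sort →
    (T : Set) (leq : BRel T) → IsTotalPreorderB leq →
    (x : T) (s : List T) →
    filterB (λ y → leq x y ∧ leq y x) (sort T leq s) ≡ filterB (λ y → leq x y ∧ leq y x) s
corollary3p17 sort cp T leq isTotalPreorder x s = begin
  classOf (sort T leq s)                           ≡⟨ cong classOf (asort-merge T leq s) ⟨
  classOf (asort T (List T) (merge leq) [_] [] s) ≡⟨ SortedWithClassOf.sameClass related ⟩
  classOf (asort T (List T) _++_ [_] [] s)        ≡⟨ cong classOf (asort-cat T s) ⟩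
  classOf s                                        ∎
  where
    open ≡-Reasoning
    open CharacteristicProperty cp
    classOf : List T → List T
    classOf = filterB (_≈ᵇ_ leq x)

    _∼_ : List T → List T → Set
    _∼_ = SortedWithClassOf leq isTotalPreorder x

    singleton-∼ : ∀ {y₁ y₂} → y₁ ≡ y₂ → [ y₁ ] ∼ [ y₂ ]
    singleton-∼ refl = [] ∷ [] , refl

    related : asort T (List T) (merge leq) [_] [] s ∼ asort T (List T) _++_ [_] [] s
    related = asort-param T T _≡_ (List T) (List T) _∼_ (merge leq) _++_
      (merge-++-SortedWithClassOf leq isTotalPreorder x) [_] [_] singleton-∼ [] [] ([] , refl)
      s s (Pointwise.refl refl)
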